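{- Let $\mathfrak C$ be a category and $\alpha:a\to a'$ a $\mathfrak C$-arrow. Then $\alpha$ is a Ramsey arrow in $\mathfrak C$ if and only if $\mathrm{id}_{(a,\alpha)}$ is a Ramsey arrow in the arrow extension $\vec{\mathfrak C}$.
   Context: Composition $g\circ f$ ($f$ first); $\mathfrak C(\alpha,b):=\{f\circ\alpha:f\in\mathfrak C(a',b)\}$ for $\alpha:a\to a'$. An arrow $\alpha:a\to a'$ in a category $\mathfrak C$ is a Ramsey arrow if for every object $b$, $k\in\mathbb N$ and finite $F\subseteq\mathfrak C(\alpha,b)$ there is an object $v$ such that for every $\phi:\mathfrak C(\alpha,v)\to k$ there is $e\in\mathfrak C(b,v)$ with $\phi$ constant on $e\circ F$. The arrow extension $\vec{\mathfrak C}$ of $\mathfrak C$: its objects are the $\mathfrak C$-arrows $\alpha:a\to a'$ (written $(a,\alpha)$); a $\vec{\mathfrak C}$-arrow $(a,\alpha)\to(b,\beta)$ is a $\mathfrak C$-arrow $f:a\to b$ such that $f=f'\circ\alpha$ for some $\mathfrak C$-arrow $f'$, or $f=\mathrm{id}_a$ when $\alpha=\beta$; composition is that of $\mathfrak C$. -}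

module Defs where

open import Level using (Level; _⊔_) renaming (suc to lsuc)
open import Data.Nat using (ℕ)
open import Data.Fin using (Fin)
open import Data.Product using (Σ; ∃; _,_; proj₁; proj₂)
open import Data.Sum using (_⊎_; inj₁; inj₂)
open import Data.List using (List)
open import Data.List.Membership.Propositional using (_∈_)
open import Relation.Binary.PropositionalEquality
  using (_≡_; refl; sym; trans; cong; cong₂; subst)

record Category (o h : Level) : Set (lsuc (o ⊔ h)) where
  infixr 9 _∘_
  field
    Obj  : Set o
    Hom  : Obj → Obj → Set h
    id   : ∀ {a} → Hom a a
    _∘_  : ∀ {a b c} → Hom b c → Hom a b → Hom a c
    assoc : ∀ {a b c d} (f : Hom a b) (g : Hom b c) (k : Hom c d) →
            k ∘ (g ∘ f) ≡ (k ∘ g) ∘ f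
    identityˡ : ∀ {a b} (f : Hom a b) → id ∘ f ≡ f
    identityʳ : ∀ {a b} (f : Hom a b) → f ∘ id ≡ f

module _ {o h : Level} (C : Category o h) where
  open Category C

  -- Elements of 𝔆(α,b) = { f ∘ α : f ∈ 𝔆(a',b) }, as a subset of 𝔆(a,b).
  -- The membership proof is irrelevant, so elements are determined by the arrow.
  record CAlpha {a a' : Obj} (α : Hom a a') (b : Obj) : Set h where
    constructor mkCα
    field
      arr : Hom a b
      .factors : ∃ λ (f : Hom a' b) → arr ≡ f ∘ α

  open CAlpha public

  postCompFactors : ∀ {a a' b v} {α : Hom a a'} (e : Hom b v) (g : Hom a b) →
    (∃ λ (f : Hom a' b) → g ≡ f ∘ α) → ∃ λ (f : Hom a' v) → e ∘ g ≡ f ∘ α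
  postCompFactors {α = α} e g (f , p) = e ∘ f , trans (cong (e ∘_) p) (assoc α f e)

  postComp : ∀ {a a' b v} {α : Hom a a'} → Hom b v → CAlpha α b → CAlpha α v
  postComp e (mkCα g p) = mkCα (e ∘ g) (postCompFactors e g p)

  IsRamseyArrow : ∀ {a a'} → Hom a a' → Set (o ⊔ h)
  IsRamseyArrow α =
    ∀ (b : Obj) (k : ℕ) (F : List (CAlpha α b)) →
    ∃ λ (v : Obj) → ∀ (φ : CAlpha α v → Fin k) →
      ∃ λ (e : Hom b v) → ∀ {x y} → x ∈ F → y ∈ F →
        φ (postComp e x) ≡ φ (postComp e y)

module ArrowExtension {o h : Level} (C : Category o h) where
  open Category C

  AObj : Set (o ⊔ h)
  AObj = Σ Obj λ a → Σ Obj λ a' → Hom a a'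

  src : AObj → Obj
  src (a , _) = a

  arrOf : (X : AObj) → Hom (src X) (proj₁ (proj₂ X))
  arrOf (_ , _ , α) = α

  data IsIdArr : (X Y : AObj) → Hom (src X) (src Y) → Set (o ⊔ h) where
    isId : ∀ {X} → IsIdArr X X id

  Allowed : (X Y : AObj) → Hom (src X) (src Y) → Set (o ⊔ h)
  Allowed X Y f = (∃ λ (f' : Hom (proj₁ (proj₂ X)) (src Y)) → f ≡ f' ∘ arrOf X)
                  ⊎ IsIdArr X Y f

  record AHom (X Y : AObj) : Set (o ⊔ h) where
    constructor mkA
    field
      harr : Hom (src X) (src Y)
      .allowed : Allowed X Y harr

  open AHom

  allowedId : ∀ {X} → Allowed X X id
  allowedId = inj₂ isId

  allowedComp : ∀ {X Y Z} (g : Hom (src Y) (src Z)) (f : Hom (src X) (src Y)) →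
    Allowed Y Z g → Allowed X Y f → Allowed X Z (g ∘ f)
  allowedComp {X} g f pg (inj₁ (f' , p)) =
    inj₁ (g ∘ f' , trans (cong (g ∘_) p) (assoc (arrOf X) f' g))
  allowedComp g f (inj₁ (g' , q)) (inj₂ isId) =
    inj₁ (g' , trans (identityʳ g) q)
  allowedComp g f (inj₂ isId) (inj₂ isId) =
    subst (Allowed _ _) (sym (identityˡ id)) (inj₂ isId)

  _∘A_ : ∀ {X Y Z} → AHom Y Z → AHom X Y → AHom X Z
  mkA g pg ∘A mkA f pf = mkA (g ∘ f) (allowedComp g f pg pf)

  idA : ∀ {X} → AHom X X
  idA = mkA id allowedId

  ≡A : ∀ {X Y} {f g : Hom (src X) (src Y)} .{p : Allowed X Y f} .{q : Allowed X Y g} →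
       f ≡ g → mkA f p ≡ mkA g q
  ≡A refl = refl

  arrowExt : Category (o ⊔ h) (o ⊔ h)
  arrowExt = record
    { Obj = AObj
    ; Hom = AHom
    ; id = idA
    ; _∘_ = _∘A_
    ; assoc = λ f g k → ≡A (assoc (harr f) (harr g) (harr k))
    ; identityˡ = λ f → ≡A (identityˡ (harr f))
    ; identityʳ = λ f → ≡A (identityʳ (harr f))
    }

open ArrowExtension public using (arrowExt)

-- A C-arrow f ∘ α : a → b is the same thing as an arrow (a,α) → (b,id_b) of the arrow
-- extension, and an arrow g : (a,α) → (b,β) of the arrow extension yields β ∘ g ∈ C(α,b').
-- Both translations commute with post-composition, so a colouring of one side pulls back
-- along them to a colouring of the other, and a monochromatic witness pushes forward.
module Submission where

open import Level using (_⊔_)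
open import Data.Fin using (Fin)
open import Data.Product using (_×_; _,_; ∃; proj₁; proj₂)
open import Data.Sum using (inj₁; inj₂)
open import Data.List using (map)
open import Data.List.Membership.Propositional using (_∈_)
open import Data.List.Membership.Propositional.Properties using (∈-map⁺)
open import Relation.Binary.PropositionalEquality
  using (_≡_; refl; sym; trans; cong; module ≡-Reasoning)

open import Defs

CAlpha-≡ : ∀ {o h} (C : Category o h) {a a' b} {α : Category.Hom C a a'}
           {x y : CAlpha C α b} → arr x ≡ arr y → x ≡ y
CAlpha-≡ C {x = mkCα _ _} {mkCα _ _} refl = refl

record RamseyTransfer {o h o' h'} (D : Category o h) (E : Category o' h')
       {d d' : Category.Obj D} (δ : Category.Hom D d d')
       {e e' : Category.Obj E} (ε : Category.Hom E e e') : Set (o ⊔ h ⊔ o' ⊔ h') where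
  private
    module D = Category D
    module E = Category E
  field
    source-obj : E.Obj → D.Obj
    target-obj : D.Obj → E.Obj
    encode     : ∀ {B} → CAlpha E ε B → CAlpha D δ (source-obj B)
    decode     : ∀ {v} → CAlpha D δ v → CAlpha E ε (target-obj v)
    lift       : ∀ {B v} → D.Hom (source-obj B) v → E.Hom B (target-obj v)
    decode-postComp-encode : ∀ {B v} (f : D.Hom (source-obj B) v) (x : CAlpha E ε B) →
                             decode (postComp D f (encode x)) ≡ postComp E (lift f) x

module _ {o h o' h'} {D : Category o h} {E : Category o' h'}
         {d d'} {δ : Category.Hom D d d'} {e e'} {ε : Category.Hom E e e'} where

  transfer-isRamseyArrow : RamseyTransfer D E δ ε → IsRamseyArrow D δ → IsRamseyArrow E ε
  transfer-isRamseyArrow T ramsey B k F = target-obj v , monochromatic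
    where
    open RamseyTransfer T
    ramsey-encoded = ramsey (source-obj B) k (map encode F)
    v = proj₁ ramsey-encoded

    monochromatic : ∀ (φ : CAlpha E ε (target-obj v) → Fin k) →
      ∃ λ (f : Category.Hom E B (target-obj v)) → ∀ {x y} → x ∈ F → y ∈ F →
        φ (postComp E f x) ≡ φ (postComp E f y)
    monochromatic φ = lift f , constant
      where
      witness = proj₂ ramsey-encoded (λ z → φ (decode z))
      f = proj₁ witness

      constant : ∀ {x y} → x ∈ F → y ∈ F → φ (postComp E (lift f) x) ≡ φ (postComp E (lift f) y)
      constant {x} {y} x∈F y∈F = begin
        φ (postComp E (lift f) x)              ≡⟨ cong φ (sym (decode-postComp-encode f x)) ⟩
        φ (decode (postComp D f (encode x)))   ≡⟨ proj₂ witness (∈-map⁺ encode x∈F) (∈-map⁺ encode y∈F) ⟩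
        φ (decode (postComp D f (encode y)))   ≡⟨ cong φ (decode-postComp-encode f y) ⟩
        φ (postComp E (lift f) y)              ∎
        where open ≡-Reasoning

module _ {o h} (C : Category o h) {a a' : Category.Obj C} (α : Category.Hom C a a') where
  open Category C
  open ArrowExtension C hiding (arrowExt)
  open AHom

  private
    AC = arrowExt C

    X : AObj
    X = a , a' , α

    target : AObj → Obj
    target (_ , b' , _) = b'

    identityObj : Obj → AObj
    identityObj b = b , b , id

  allowed⇒arrOf∘-factors : (Y : AObj) (g : Hom a (src Y)) → Allowed X Y g →
                           ∃ λ (f : Hom a' (target Y)) → arrOf Y ∘ g ≡ f ∘ α
  allowed⇒arrOf∘-factors Y g (inj₁ (f , g≡f∘α)) = arrOf Y ∘ f , trans (cong (arrOf Y ∘_) g≡f∘α) (assoc α f (arrOf Y))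
  allowed⇒arrOf∘-factors Y g (inj₂ isId)        = id , trans (identityʳ α) (sym (identityˡ α))

  toArrowExt : ∀ {b} → CAlpha C α b → CAlpha AC idA (identityObj b)
  toArrowExt (mkCα g g-factors) = mkCα (mkA g (inj₁ g-factors)) (mkA g (inj₁ g-factors) , ≡A (sym (identityʳ g)))

  fromArrowExt : ∀ {Y} → CAlpha AC idA Y → CAlpha C α (target Y)
  fromArrowExt {Y} (mkCα (mkA g g-allowed) _) = mkCα (arrOf Y ∘ g) (allowed⇒arrOf∘-factors Y g g-allowed)

  toArrowExt-transfer : RamseyTransfer C AC α (idA {X})
  toArrowExt-transfer = record
    { source-obj = target
    ; target-obj = identityObj
    ; encode     = fromArrowExt
    ; decode     = toArrowExt
    ; lift       = λ {B} f → mkA (f ∘ arrOf B) (inj₁ (f , refl))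
    ; decode-postComp-encode = λ {B} f → λ { (mkCα (mkA g _) _) →
        CAlpha-≡ AC (≡A (assoc g (arrOf B) f)) }
    }

  fromArrowExt-transfer : RamseyTransfer AC C (idA {X}) α
  fromArrowExt-transfer = record
    { source-obj = identityObj
    ; target-obj = target
    ; encode     = toArrowExt
    ; decode     = fromArrowExt
    ; lift       = λ {_} {V} f → arrOf V ∘ harr f
    ; decode-postComp-encode = λ {_} {V} f → λ { (mkCα g _) →
        CAlpha-≡ C (assoc g (harr f) (arrOf V)) }
    }

mainTheorem9 : ∀ {o h} (C : Category o h) {a a' : Category.Obj C}
    (α : Category.Hom C a a') →
    (IsRamseyArrow C α → IsRamseyArrow (arrowExt C) (Category.id (arrowExt C) {a , a' , α}))
    × (IsRamseyArrow (arrowExt C) (Category.id (arrowExt C) {a , a' , α}) → IsRamseyArrow C α)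
mainTheorem9 C α = transfer-isRamseyArrow (toArrowExt-transfer C α)
                 , transfer-isRamseyArrow (fromArrowExt-transfer C α)
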